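{- Let $G$ be a connected graph with $\Delta(G)\geq 3$ and let $m\in\mathbb{N}$. Then $\chi(G^{\frac{m}{m+1}})=\omega(G^{\frac{m}{m+1}})$.
   Context: All graphs are finite and simple; $\Delta$ is the maximum degree, $\chi$ the chromatic number, $\omega$ the clique number. For a graph $H$ and $m\in\mathbb{N}$, the $m$-power $H^m$ has vertex set $V(H)$, with distinct vertices $x,y$ adjacent iff $1\le d_H(x,y)\le m$. For $n\in\mathbb{N}$, the $n$-subdivision $G^{\frac1n}$ is obtained from $G$ by replacing each edge by a path of length $n$. The fractional power $G^{\frac{m}{n}}$ is $(G^{\frac1n})^m$. -}

module Defs where

open import Data.Nat using (ℕ; zero; suc; _+_; _∸_; _≤_; _⊔_; _<ᵇ_)
open import Data.Bool using (Bool; true; false; T; _∧_)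
open import Data.Fin using (Fin; toℕ)
open import Data.List using (List; length; map; foldr; filterᵇ; allFin)
open import Data.Product using (Σ; ∃; _×_; _,_; proj₁; proj₂)
open import Data.Sum using (_⊎_; inj₁; inj₂)
open import Relation.Binary.PropositionalEquality using (_≡_; _≢_)

record SimpleGraph (k : ℕ) : Set where
  field
    adj    : Fin k → Fin k → Bool
    sym    : ∀ u v → adj u v ≡ adj v u
    irrefl : ∀ u → adj u u ≡ false
open SimpleGraph public

degree : ∀ {k} → SimpleGraph k → Fin k → ℕ
degree {k} G v = length (filterᵇ (adj G v) (allFin k))

Δ : ∀ {k} → SimpleGraph k → ℕ
Δ {k} G = foldr _⊔_ 0 (map (degree G) (allFin k))

record Graph : Set₁ where
  field
    V    : Set
    Adj  : V → V → Set
open Graph public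

toGraph : ∀ {k} → SimpleGraph k → Graph
toGraph {k} G = record { V = Fin k ; Adj = λ u v → T (adj G u v) }

data Walk (H : Graph) : V H → V H → ℕ → Set where
  here : ∀ x → Walk H x x 0
  step : ∀ {x y z ℓ} → Adj H x y → Walk H y z ℓ → Walk H x z (suc ℓ)

Connected : Graph → Set
Connected H = ∀ x y → ∃ λ ℓ → Walk H x y ℓ

power : Graph → ℕ → Graph
power H m = record
  { V   = V H
  ; Adj = λ x y → x ≢ y × ∃ λ ℓ → ℓ ≤ m × Walk H x y ℓ }

-- Each edge is represented once, as an ordered pair (u , v) with u < v.
-- The edge uv is replaced by the path u = p₀, p₁, …, p_{n-1}, p_n = v,
-- whose internal vertices p_{i+1} (i : Fin (n ∸ 1)) are new.

Edge : ∀ {k} → SimpleGraph k → Set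
Edge {k} G = Σ (Fin k × Fin k) λ e →
  T ((toℕ (proj₁ e) <ᵇ toℕ (proj₂ e)) ∧ adj G (proj₁ e) (proj₂ e))

src tgt : ∀ {k} {G : SimpleGraph k} → Edge G → Fin k
src e = proj₁ (proj₁ e)
tgt e = proj₂ (proj₁ e)

SubV : ∀ {k} → SimpleGraph k → ℕ → Set
SubV {k} G n = Fin k ⊎ (Edge G × Fin (n ∸ 1))

data SubArc {k} (G : SimpleGraph k) (n : ℕ) : SubV G n → SubV G n → Set where
  whole  : (e : Edge G) → n ≡ 1 →
           SubArc G n (inj₁ (src {G = G} e)) (inj₁ (tgt {G = G} e))
  first  : (e : Edge G) (i : Fin (n ∸ 1)) → toℕ i ≡ 0 →
           SubArc G n (inj₁ (src {G = G} e)) (inj₂ (e , i))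
  middle : (e : Edge G) (i j : Fin (n ∸ 1)) → toℕ j ≡ suc (toℕ i) →
           SubArc G n (inj₂ (e , i)) (inj₂ (e , j))
  last   : (e : Edge G) (i : Fin (n ∸ 1)) → suc (suc (toℕ i)) ≡ n →
           SubArc G n (inj₂ (e , i)) (inj₁ (tgt {G = G} e))

subdivision : ∀ {k} → SimpleGraph k → ℕ → Graph
subdivision G n = record
  { V   = SubV G n
  ; Adj = λ x y → SubArc G n x y ⊎ SubArc G n y x }

fracPower : ∀ {k} → SimpleGraph k → ℕ → ℕ → Graph
fracPower G m n = power (subdivision G n) m

Colorable : Graph → ℕ → Set
Colorable H c = Σ (V H → Fin c) λ f → ∀ x y → Adj H x y → f x ≢ f y

HasClique : Graph → ℕ → Set
HasClique H c = Σ (Fin c → V H) λ f → ∀ i j → i ≢ j → Adj H (f i) (f j)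

IsChromaticNumber : Graph → ℕ → Set
IsChromaticNumber H c = Colorable H c × (∀ d → Colorable H d → c ≤ d)

IsCliqueNumber : Graph → ℕ → Set
IsCliqueNumber H c = HasClique H c × (∀ d → HasClique H d → d ≤ c)

-- Let t = ⌊m/2⌋ and Δ = Δ(G).
-- A vertex u of degree Δ, the internal vertices at distance 1, …, t from u on each of its edges and, for odd m,
-- one vertex at distance t + 1 from u are pairwise at distance ≤ m: a clique of size (m − 2t + 1) + tΔ.
-- The same number of colours suffices. Label the darts of G by Δ labels, injectively at each vertex and with
-- the two darts of every edge labelled differently; such a labelling is built edge by edge, repairing conflicts
-- along Kempe chains. All original vertices get one colour, the internal vertex at distance a + 1 ≤ t from the
-- end v of the edge vw gets the colour (a, label of vw), and for odd m the midpoints of edges get one more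
-- colour. Two vertices of the same colour are more than m apart; this is read off from truncated distance
-- functions that change by at most one along each edge of the subdivision.

module Submission where

open import Defs renaming (sym to adj-sym)
open import Data.Nat
  using (ℕ; zero; suc; _+_; _∸_; _*_; _⊔_; _⊓_; _≤_; _<_; _≤′_; ≤′-refl; ≤′-step; _<?_; ∣_-_∣; _<ᵇ_; z≤n; s≤s)
open import Data.Nat.Properties hiding (_≟_)
open import Data.Bool using (T; _∧_; if_then_else_)
open import Data.Bool.Properties using (T-irrelevant; T-∧)
open import Data.Fin using (Fin; zero; suc; toℕ; fromℕ<; join; splitAt; combine; remQuot)
open import Data.Fin.Properties
  using (_≟_; any?; all?; ¬∀⟶∃¬; pigeonhole; injective⇒≤; toℕ<n; toℕ-injective; toℕ-fromℕ<;
         splitAt-join; join-splitAt; remQuot-combine; combine-remQuot)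
open import Data.Fin.Permutation.Components using (transpose; transpose-inverse)
open import Data.Maybe using (Maybe; just; nothing; _>>=_)
open import Data.Maybe.Properties using (just-injective)
import Data.Maybe.Properties as Maybe
open import Data.List using (List; []; _∷_; lookup; allFin; map; foldr; filterᵇ; cartesianProduct)
open import Data.List.Relation.Unary.Any as Any using (here; there)
open import Data.List.Relation.Unary.Any.Properties using (lookup-index)
import Data.List.Relation.Unary.All as All
open import Data.List.Relation.Unary.AllPairs using (_∷_)
open import Data.List.Relation.Unary.Unique.Propositional using (Unique)
open import Data.List.Relation.Unary.Unique.Propositional.Properties using (allFin⁺; filter⁺)
open import Data.List.Membership.Propositional using (_∈_)
open import Data.List.Membership.Propositional.Properties
  using (∈-filter⁺; ∈-filter⁻; ∈-allFin; ∈-lookup; ∈-map⁺; ∈-map⁻; ∈-cartesianProduct⁺; foldr-selective)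
open import Data.Product using (Σ; ∃; _×_; _,_; proj₁; proj₂; uncurry)
open import Data.Product.Properties using (,-injective)
import Data.Product.Properties as Product
open import Data.Sum using (_⊎_; inj₁; inj₂)
open import Data.Sum.Properties using (inj₂-injective)
import Data.Sum as Sum
open import Data.Empty using (⊥; ⊥-elim)
open import Function using (_∘_)
open import Function.Bundles using (Equivalence)
open import Function.Definitions using (Injective)
open import Relation.Nullary using (¬_; Dec; yes; no; does; contradiction)
open import Relation.Nullary.Decidable using (_×-dec_; _⊎-dec_; dec-true; dec-false; T?)
open import Relation.Binary using (tri<; tri≈; tri>)
open import Relation.Binary.PropositionalEquality
  using (_≡_; _≢_; refl; sym; trans; cong; cong₂; subst; subst₂)


lookup-injective : ∀ {A : Set} {xs : List A} → Unique xs → Injective _≡_ _≡_ (lookup xs)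
lookup-injective {xs = _ ∷ _} _ {zero}  {zero}  _  = refl
lookup-injective (x∉xs ∷ _)   {zero}  {suc j} eq = ⊥-elim (All.lookup x∉xs (∈-lookup j) eq)
lookup-injective (x∉xs ∷ _)   {suc i} {zero}  eq = ⊥-elim (All.lookup x∉xs (∈-lookup i) (sym eq))
lookup-injective (_ ∷ unique) {suc i} {suc j} eq = cong suc (lookup-injective unique eq)

∈⇒≤foldr-⊔ : ∀ {x xs} → x ∈ xs → x ≤ foldr _⊔_ 0 xs
∈⇒≤foldr-⊔ (here refl) = m≤m⊔n _ _
∈⇒≤foldr-⊔ (there x∈xs) = m≤n⇒m≤o⊔n _ (∈⇒≤foldr-⊔ x∈xs)

module _ {k : ℕ} (G : SimpleGraph k) where

  NeighbourEnumeration : Fin k → ℕ → Set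
  NeighbourEnumeration v n = Σ (Fin n → Fin k) λ h → Injective _≡_ _≡_ h × (∀ i → T (adj G v (h i)))

  enumeration⇒≤degree : ∀ {v n} → NeighbourEnumeration v n → n ≤ degree G v
  enumeration⇒≤degree {v} (h , h-inj , h-adj) = injective⇒≤ position-inj
    where
    neighbours = filterᵇ (adj G v) (allFin k)
    position : ∀ i → h i ∈ neighbours
    position i = ∈-filter⁺ (T? ∘ adj G v) (∈-allFin (h i)) (h-adj i)
    position-inj : Injective _≡_ _≡_ (Any.index ∘ position)
    position-inj {i} {j} eq =
      h-inj (trans (lookup-index (position i)) (trans (cong (lookup neighbours) eq) (sym (lookup-index (position j)))))

  neighbourEnumeration : ∀ v → NeighbourEnumeration v (degree G v)
  neighbourEnumeration v =
    lookup (filterᵇ (adj G v) (allFin k)) ,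
    lookup-injective (filter⁺ (T? ∘ adj G v) (allFin⁺ k)) ,
    λ i → proj₂ (∈-filter⁻ (T? ∘ adj G v) {xs = allFin k} (∈-lookup i))

  degree≤Δ : ∀ v → degree G v ≤ Δ G
  degree≤Δ v = ∈⇒≤foldr-⊔ (∈-map⁺ (degree G) (∈-allFin v))

  Δ-attained : 1 ≤ Δ G → ∃ λ v → degree G v ≡ Δ G
  Δ-attained 1≤Δ with foldr-selective ⊔-sel 0 (map (degree G) (allFin k))
  ... | inj₁ Δ≡0 with () ← subst (1 ≤_) Δ≡0 1≤Δ
  ... | inj₂ Δ∈ with ∈-map⁻ (degree G) Δ∈
  ...   | v , _ , Δ≡deg = v , sym Δ≡deg

_≟²_ : ∀ {k} (p q : Fin k × Fin k) → Dec (p ≡ q)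
_≟²_ = Product.≡-dec _≟_ _≟_

another : ∀ {n} → 2 ≤ n → (x : Fin n) → ∃ (x ≢_)
another (s≤s (s≤s _)) zero    = suc zero , λ ()
another (s≤s (s≤s _)) (suc _) = zero , λ ()

module _ {k D : ℕ} where

  Labelling : Set
  Labelling = Fin k → Fin k → Fin D

  EdgeRel : Set₁
  EdgeRel = Fin k → Fin k → Set

  record IsDartLabelling (E : EdgeRel) (lab : Labelling) : Set where
    field
      injective-at : ∀ u v w → E u v → E u w → lab u v ≡ lab u w → v ≡ w
      ends-differ  : ∀ u v → E u v → lab u v ≢ lab v u
  open IsDartLabelling

  Unused : EdgeRel → Labelling → Fin k → Fin D → Set
  Unused E lab a ℓ = ∀ v → E a v → lab a v ≢ ℓ

  restrict : ∀ {E E′ lab} → (∀ {u v} → E′ u v → E u v) → IsDartLabelling E lab → IsDartLabelling E′ lab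
  restrict E′⊆E dl = record
    { injective-at = λ u v w ev ew → injective-at dl u v w (E′⊆E ev) (E′⊆E ew)
    ; ends-differ  = λ u v e → ends-differ dl u v (E′⊆E e) }

  -- Swapping x and y at every vertex of the chain a → … that follows darts labelled y with reverse labelled x
  -- keeps a dart labelling, frees y at a and leaves b alone.
  module KempeChain (E : EdgeRel) (E-sym : ∀ {u v} → E u v → E v u) (E? : ∀ u v → Dec (E u v))
                    {lab : Labelling} (dl : IsDartLabelling E lab) {a b : Fin k} (a≢b : a ≢ b)
                    {x y : Fin D} (x≢y : x ≢ y) (x∉a : Unused E lab a x) (x∉b : Unused E lab b x) where

    Link : Fin k → Fin k → Set
    Link v w = E v w × lab v w ≡ y × lab w v ≡ x

    link-unique : ∀ {v w w′} → Link v w → Link v w′ → w ≡ w′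
    link-unique (e , ℓ≡y , _) (e′ , ℓ′≡y , _) = injective-at dl _ _ _ e e′ (trans ℓ≡y (sym ℓ′≡y))

    link? : ∀ v w → Dec (Link v w)
    link? v w = E? v w ×-dec (lab v w ≟ y) ×-dec (lab w v ≟ x)

    next : Fin k → Maybe (Fin k)
    next v with any? (link? v)
    ... | yes (w , _) = just w
    ... | no _        = nothing

    next-sound : ∀ v w → next v ≡ just w → Link v w
    next-sound v w eq with any? (link? v)
    next-sound v w refl | yes (_ , link) = link

    next-complete : ∀ {v w} → Link v w → next v ≡ just w
    next-complete {v} {w} link with any? (link? v)
    ... | yes (_ , link′) = cong just (link-unique link′ link)
    ... | no no-link      = ⊥-elim (no-link (w , link))

    chain : ℕ → Maybe (Fin k)
    chain zero    = just a
    chain (suc n) = chain n >>= next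

    chain-pred : ∀ n {w} → chain (suc n) ≡ just w → ∃ λ v → chain n ≡ just v × Link v w
    chain-pred n eq with chain n
    ... | just v = v , refl , next-sound v _ eq

    chain-suc : ∀ n {v w} → chain n ≡ just v → Link v w → chain (suc n) ≡ just w
    chain-suc n eq link rewrite eq = next-complete link

    chain-defined-below : ∀ {i n w} → i ≤′ n → chain n ≡ just w → ∃ λ v → chain i ≡ just v
    chain-defined-below ≤′-refl          eq = _ , eq
    chain-defined-below (≤′-step {n} le) eq = chain-defined-below le (proj₁ (proj₂ (chain-pred n eq)))

    -- a chain vertex has only one chain predecessor, because x is unused at a
    chain-injective : ∀ i j {w} → i < j → chain i ≡ just w → chain j ≡ just w → ⊥
    chain-injective zero (suc j) _ refl eqj with chain-pred j eqj
    ... | p , _ , (e , _ , ℓ≡x) = x∉a p (E-sym e) ℓ≡x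
    chain-injective (suc i) (suc j) (s≤s i<j) eqi eqj with chain-pred i eqi | chain-pred j eqj
    ... | p , eqp , (e , _ , ℓ≡x) | p′ , eqp′ , (e′ , _ , ℓ′≡x)
      with refl ← injective-at dl _ p p′ (E-sym e) (E-sym e′) (trans ℓ≡x (sym ℓ′≡x))
      = chain-injective i j i<j eqp eqp′

    chain-defined-up-to : ∀ {n w} → chain n ≡ just w → (i : Fin (suc n)) → ∃ λ v → chain (toℕ i) ≡ just v
    chain-defined-up-to eq i = chain-defined-below (≤⇒≤′ (≤-pred (toℕ<n i))) eq

    chain-halts : chain k ≡ nothing
    chain-halts with chain k in eq
    ... | nothing = refl
    ... | just _ with i , j , i<j , same ← pigeonhole (n<1+n k) (proj₁ ∘ chain-defined-up-to eq)
      = ⊥-elim (chain-injective (toℕ i) (toℕ j) i<j (proj₂ (chain-defined-up-to eq i))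
                  (subst (λ w → chain (toℕ j) ≡ just w) (sym same) (proj₂ (chain-defined-up-to eq j))))

    InChain : Fin k → Set
    InChain w = ∃ λ n → chain n ≡ just w

    inChain⇒index<k : ∀ {n w} → chain n ≡ just w → n < k
    inChain⇒index<k {n} eq with <-cmp n k
    ... | tri< n<k _ _ = n<k
    ... | tri≈ _ refl _ with () ← trans (sym eq) chain-halts
    ... | tri> _ _ k<n with () ← trans (sym (proj₂ (chain-defined-below (≤⇒≤′ (<⇒≤ k<n)) eq))) chain-halts

    inChain? : ∀ w → Dec (InChain w)
    inChain? w with any? (λ (i : Fin k) → Maybe.≡-dec _≟_ (chain (toℕ i)) (just w))
    ... | yes (i , eq) = yes (toℕ i , eq)
    ... | no none      = no λ (n , eq) → let n<k = inChain⇒index<k {n} eq in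
      none (fromℕ< n<k , subst (λ n → chain n ≡ just w) (sym (toℕ-fromℕ< n<k)) eq)

    a∈chain : InChain a
    a∈chain = 0 , refl

    b∉chain : ¬ InChain b
    b∉chain (zero  , eq) = a≢b (just-injective eq)
    b∉chain (suc n , eq) with chain-pred n eq
    ... | p , _ , (e , _ , ℓ≡x) = x∉b p (E-sym e) ℓ≡x

    chain-closed-link : ∀ {v w} → InChain v → Link v w → InChain w
    chain-closed-link (n , eq) link = suc n , chain-suc n eq link

    -- the only x-labelled dart out of a chain vertex leads back to its predecessor
    chain-closed-x : ∀ {u v} → InChain u → E u v → lab u v ≡ x → InChain v
    chain-closed-x (zero , refl) e ℓ≡x = ⊥-elim (x∉a _ e ℓ≡x)
    chain-closed-x (suc n , eq) e ℓ≡x with chain-pred n eq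
    ... | p , eqp , (e′ , _ , ℓ′≡x) with refl ← injective-at dl _ _ p e (E-sym e′) (trans ℓ≡x (sym ℓ′≡x))
      = n , eqp

    swap : Fin D → Fin D
    swap = transpose x y

    swap-x : swap x ≡ y
    swap-x rewrite dec-true (x ≟ x) refl = refl

    swap-y : swap y ≡ x
    swap-y rewrite dec-false (y ≟ x) (x≢y ∘ sym) | dec-true (y ≟ y) refl = refl

    swap-other : ∀ {ℓ} → ℓ ≢ x → ℓ ≢ y → swap ℓ ≡ ℓ
    swap-other {ℓ} ℓ≢x ℓ≢y rewrite dec-false (ℓ ≟ x) ℓ≢x | dec-false (ℓ ≟ y) ℓ≢y = refl

    swap-injective : ∀ {ℓ ℓ′} → swap ℓ ≡ swap ℓ′ → ℓ ≡ ℓ′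
    swap-injective {ℓ} {ℓ′} eq =
      trans (sym (transpose-inverse y x)) (trans (cong (transpose y x) eq) (transpose-inverse y x))

    swapped : Labelling
    swapped u v = if does (inChain? u) then swap (lab u v) else lab u v

    swapped-in : ∀ {u} v → InChain u → swapped u v ≡ swap (lab u v)
    swapped-in {u} v u∈ rewrite dec-true (inChain? u) u∈ = refl

    swapped-out : ∀ {u} v → ¬ InChain u → swapped u v ≡ lab u v
    swapped-out {u} v u∉ rewrite dec-false (inChain? u) u∉ = refl

    swap-crossing : ∀ {u v} → InChain u → ¬ InChain v → E u v → swap (lab u v) ≢ lab v u
    swap-crossing {u} {v} u∈ v∉ e eq = by-label (lab u v ≟ x) (lab u v ≟ y)
      where
      by-label : Dec (lab u v ≡ x) → Dec (lab u v ≡ y) → ⊥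
      by-label (yes ℓ≡x) _         = v∉ (chain-closed-x u∈ e ℓ≡x)
      by-label (no _)    (yes ℓ≡y) = v∉ (chain-closed-link u∈ (e , ℓ≡y , trans (sym eq) (trans (cong swap ℓ≡y) swap-y)))
      by-label (no ℓ≢x)  (no ℓ≢y)  = ends-differ dl u v e (trans (sym (swap-other ℓ≢x ℓ≢y)) eq)

    swapped-injective-at : ∀ u v w → E u v → E u w → swapped u v ≡ swapped u w → v ≡ w
    swapped-injective-at u v w ev ew eq with inChain? u
    ... | yes u∈ = injective-at dl u v w ev ew (swap-injective eq)
    ... | no u∉  = injective-at dl u v w ev ew eq

    swapped-ends-differ : ∀ u v → E u v → swapped u v ≢ swapped v u
    swapped-ends-differ u v e eq with inChain? u | inChain? v
    ... | yes _  | yes _  = ends-differ dl u v e (swap-injective eq)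
    ... | yes u∈ | no v∉  = swap-crossing u∈ v∉ e eq
    ... | no u∉  | yes v∈ = swap-crossing v∈ u∉ (E-sym e) (sym eq)
    ... | no _   | no _   = ends-differ dl u v e eq

    swapped-isDartLabelling : IsDartLabelling E swapped
    swapped-isDartLabelling = record
      { injective-at = swapped-injective-at ; ends-differ = swapped-ends-differ }

    y∉a : Unused E swapped a y
    y∉a v e eq = x∉a v e (swap-injective (trans (sym (swapped-in v a∈chain)) (trans eq (sym swap-x))))

    x∉b′ : Unused E swapped b x
    x∉b′ v e eq = x∉b v e (trans (sym (swapped-out v b∉chain)) eq)

  module AddEdge (E : EdgeRel) (E-sym : ∀ {u v} → E u v → E v u) {lab : Labelling} (dl : IsDartLabelling E lab)
                 {a b : Fin k} (a≢b : a ≢ b) (ab∉E : ¬ E a b)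
                 {p q : Fin D} (p≢q : p ≢ q) (p∉a : Unused E lab a p) (q∉b : Unused E lab b q) where

    E+ab : EdgeRel
    E+ab u v = E u v ⊎ (u ≡ a × v ≡ b) ⊎ (u ≡ b × v ≡ a)

    extended : Labelling
    extended u v = if does ((u , v) ≟² (a , b)) then p else if does ((u , v) ≟² (b , a)) then q else lab u v

    extended-ab : extended a b ≡ p
    extended-ab rewrite dec-true ((a , b) ≟² (a , b)) refl = refl

    extended-ba : extended b a ≡ q
    extended-ba rewrite dec-false ((b , a) ≟² (a , b)) (a≢b ∘ sym ∘ cong proj₁)
                      | dec-true ((b , a) ≟² (b , a)) refl = refl

    extended-E : ∀ {u v} → E u v → extended u v ≡ lab u v
    extended-E {u} {v} e
      rewrite dec-false ((u , v) ≟² (a , b)) (λ eq → ab∉E (subst₂ E (cong proj₁ eq) (cong proj₂ eq) e))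
            | dec-false ((u , v) ≟² (b , a)) (λ eq → ab∉E (subst₂ E (cong proj₂ eq) (cong proj₁ eq) (E-sym e))) = refl

    injective-at+ : ∀ u v w → E+ab u v → E+ab u w → extended u v ≡ extended u w → v ≡ w
    injective-at+ u v w (inj₁ ev) (inj₁ ew) eq =
      injective-at dl u v w ev ew (trans (sym (extended-E ev)) (trans eq (extended-E ew)))
    injective-at+ u v w (inj₁ ev) (inj₂ (inj₁ (refl , refl))) eq = ⊥-elim (p∉a v ev (trans (sym (extended-E ev)) (trans eq extended-ab)))
    injective-at+ u v w (inj₁ ev) (inj₂ (inj₂ (refl , refl))) eq = ⊥-elim (q∉b v ev (trans (sym (extended-E ev)) (trans eq extended-ba)))
    injective-at+ u v w (inj₂ (inj₁ (refl , refl))) (inj₁ ew) eq = ⊥-elim (p∉a w ew (trans (sym (extended-E ew)) (trans (sym eq) extended-ab)))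
    injective-at+ u v w (inj₂ (inj₂ (refl , refl))) (inj₁ ew) eq = ⊥-elim (q∉b w ew (trans (sym (extended-E ew)) (trans (sym eq) extended-ba)))
    injective-at+ u v w (inj₂ (inj₁ (refl , refl))) (inj₂ (inj₁ (_ , refl))) eq = refl
    injective-at+ u v w (inj₂ (inj₂ (refl , refl))) (inj₂ (inj₂ (_ , refl))) eq = refl
    injective-at+ u v w (inj₂ (inj₁ (refl , refl))) (inj₂ (inj₂ (a≡b , _))) eq = ⊥-elim (a≢b a≡b)
    injective-at+ u v w (inj₂ (inj₂ (refl , refl))) (inj₂ (inj₁ (b≡a , _))) eq = ⊥-elim (a≢b (sym b≡a))

    ends-differ+ : ∀ u v → E+ab u v → extended u v ≢ extended v u
    ends-differ+ u v (inj₁ e) eq = ends-differ dl u v e (trans (sym (extended-E e)) (trans eq (extended-E (E-sym e))))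
    ends-differ+ u v (inj₂ (inj₁ (refl , refl))) eq = p≢q (trans (sym extended-ab) (trans eq extended-ba))
    ends-differ+ u v (inj₂ (inj₂ (refl , refl))) eq = p≢q (trans (sym extended-ab) (trans (sym eq) extended-ba))

    extended-isDartLabelling : IsDartLabelling E+ab extended
    extended-isDartLabelling = record { injective-at = injective-at+ ; ends-differ = ends-differ+ }

  module _ (G : SimpleGraph k) (deg≤D : ∀ v → degree G v ≤ D) where

    adj⇒≢ : ∀ {a b} → T (adj G a b) → a ≢ b
    adj⇒≢ {a} ab refl = subst T (irrefl G a) ab

    adj-flip : ∀ {a b} → T (adj G a b) → T (adj G b a)
    adj-flip {a} {b} = subst T (adj-sym G a b)

    -- a has at most D − 1 labelled darts, since ab is not yet in E
    unused-label : ∀ {E lab} → (∀ u v → Dec (E u v)) → IsDartLabelling E lab →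
                   ∀ {a b} → T (adj G a b) → ¬ E a b → (∀ {v} → E a v → T (adj G a v)) → ∃ (Unused E lab a)
    unused-label {E} {lab} E? dl {a} {b} ab ab∉E E⊆G = by-usage (all? used?)
      where
      Used : Fin D → Set
      Used ℓ = ∃ λ v → E a v × lab a v ≡ ℓ
      used? : ∀ ℓ → Dec (Used ℓ)
      used? ℓ = any? (λ v → E? a v ×-dec (lab a v ≟ ℓ))
      all-used⇒D<degree : (∀ ℓ → Used ℓ) → suc D ≤ degree G a
      all-used⇒D<degree all-used = enumeration⇒≤degree G (h , h-injective , h-adj)
        where
        h : Fin (suc D) → Fin k
        h zero    = b
        h (suc ℓ) = proj₁ (all-used ℓ)
        labelled-≢b : ∀ ℓ → proj₁ (all-used ℓ) ≢ b
        labelled-≢b ℓ eq = ab∉E (subst (E a) eq (proj₁ (proj₂ (all-used ℓ))))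
        h-injective : ∀ {i j} → h i ≡ h j → i ≡ j
        h-injective {zero}  {zero}  _  = refl
        h-injective {zero}  {suc j} eq = ⊥-elim (labelled-≢b j (sym eq))
        h-injective {suc i} {zero}  eq = ⊥-elim (labelled-≢b i eq)
        h-injective {suc i} {suc j} eq =
          cong suc (trans (sym (proj₂ (proj₂ (all-used i)))) (trans (cong (lab a) eq) (proj₂ (proj₂ (all-used j)))))
        h-adj : ∀ i → T (adj G a (h i))
        h-adj zero    = ab
        h-adj (suc ℓ) = E⊆G (proj₁ (proj₂ (all-used ℓ)))
      by-usage : Dec (∀ ℓ → Used ℓ) → ∃ (Unused E lab a)
      by-usage (yes all-used)    = ⊥-elim (1+n≰n (≤-trans (all-used⇒D<degree all-used) (deg≤D a)))
      by-usage (no not-all-used) with ℓ , ℓ-unused ← ¬∀⟶∃¬ D Used used? not-all-used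
        = ℓ , λ v e eq → ℓ-unused (v , e , eq)

    EdgesIn : List (Fin k × Fin k) → EdgeRel
    EdgesIn L u v = T (adj G u v) × ((u , v) ∈ L ⊎ (v , u) ∈ L)

    edgesIn-sym : ∀ {L u v} → EdgesIn L u v → EdgesIn L v u
    edgesIn-sym (uv , inj₁ ∈L) = adj-flip uv , inj₂ ∈L
    edgesIn-sym (uv , inj₂ ∈L) = adj-flip uv , inj₁ ∈L

    edgesIn? : ∀ L u v → Dec (EdgesIn L u v)
    edgesIn? L u v = T? (adj G u v) ×-dec ((u , v) ∈? L ⊎-dec (v , u) ∈? L)
      where open import Data.List.Membership.DecPropositional _≟²_ using (_∈?_)

    edgesIn-∷ : ∀ {a b L u v} → EdgesIn ((a , b) ∷ L) u v →
                EdgesIn L u v ⊎ (u ≡ a × v ≡ b) ⊎ (u ≡ b × v ≡ a)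
    edgesIn-∷ (_  , inj₁ (here refl))  = inj₂ (inj₁ (refl , refl))
    edgesIn-∷ (uv , inj₁ (there ∈L))   = inj₁ (uv , inj₁ ∈L)
    edgesIn-∷ (_  , inj₂ (here refl))  = inj₂ (inj₂ (refl , refl))
    edgesIn-∷ (uv , inj₂ (there ∈L))   = inj₁ (uv , inj₂ ∈L)

    edgesIn-∷-redundant : ∀ {a b L} → (T (adj G a b) → EdgesIn L a b) →
                          ∀ {u v} → EdgesIn ((a , b) ∷ L) u v → EdgesIn L u v
    edgesIn-∷-redundant old e with edgesIn-∷ e
    ... | inj₁ e′                   = e′
    ... | inj₂ (inj₁ (refl , refl)) = old (proj₁ e)
    ... | inj₂ (inj₂ (refl , refl)) = edgesIn-sym (old (adj-flip (proj₁ e)))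

    module _ (2≤D : 2 ≤ D) where

      add-new-edge : ∀ {L lab a b} → IsDartLabelling (EdgesIn L) lab → T (adj G a b) → ¬ EdgesIn L a b →
                     Σ Labelling (IsDartLabelling (EdgesIn ((a , b) ∷ L)))
      add-new-edge {L} {lab} {a} {b} dl ab ab∉ with p , p∉a ← unused-label (edgesIn? L) dl ab ab∉ proj₁
                                                 | q , q∉b ← unused-label (edgesIn? L) dl (adj-flip ab) (ab∉ ∘ edgesIn-sym) proj₁
        = by-labels (p ≟ q)
        where
        by-labels : Dec (p ≡ q) → Σ Labelling (IsDartLabelling (EdgesIn ((a , b) ∷ L)))
        by-labels (no p≢q) = A.extended , restrict edgesIn-∷ A.extended-isDartLabelling
          where module A = AddEdge (EdgesIn L) edgesIn-sym dl (adj⇒≢ ab) ab∉ p≢q p∉a q∉b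
        -- p is free at both ends: swapping p with another label y along the Kempe chain from a
        -- frees y at a and keeps p free at b
        by-labels (yes refl) = A.extended , restrict edgesIn-∷ A.extended-isDartLabelling
          where
          p≢y : p ≢ proj₁ (another 2≤D p)
          p≢y = proj₂ (another 2≤D p)
          module K = KempeChain (EdgesIn L) edgesIn-sym (edgesIn? L) dl (adj⇒≢ ab) p≢y p∉a q∉b
          module A = AddEdge (EdgesIn L) edgesIn-sym K.swapped-isDartLabelling (adj⇒≢ ab) ab∉ (p≢y ∘ sym) K.y∉a K.x∉b′

      dartLabellingOf : ∀ L → Σ Labelling (IsDartLabelling (EdgesIn L))
      dartLabellingOf [] = (λ _ _ → fromℕ< 2≤D) , record
        { injective-at = λ { _ _ _ (_ , inj₁ ()) _ _ ; _ _ _ (_ , inj₂ ()) _ _ }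
        ; ends-differ  = λ { _ _ (_ , inj₁ ()) ; _ _ (_ , inj₂ ()) } }
      dartLabellingOf ((a , b) ∷ L) with dartLabellingOf L | T? (adj G a b)
      ... | lab , dl | no ¬ab = lab , restrict (edgesIn-∷-redundant (⊥-elim ∘ ¬ab)) dl
      ... | lab , dl | yes ab with edgesIn? L a b
      ...   | yes ab∈ = lab , restrict (edgesIn-∷-redundant λ _ → ab∈) dl
      ...   | no ab∉  = add-new-edge dl ab ab∉

      dartLabelling : Σ Labelling (IsDartLabelling (λ u v → T (adj G u v)))
      dartLabelling with lab , dl ← dartLabellingOf (cartesianProduct (allFin k) (allFin k))
        = lab , restrict (λ {u} {v} uv → uv , inj₁ (∈-cartesianProduct⁺ (∈-allFin u) (∈-allFin v))) dl

m∸n≤1+m∸[1+n] : ∀ m n → m ∸ n ≤ suc (m ∸ suc n)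
m∸n≤1+m∸[1+n] zero    zero    = z≤n
m∸n≤1+m∸[1+n] zero    (suc n) = z≤n
m∸n≤1+m∸[1+n] (suc m) zero    = ≤-refl
m∸n≤1+m∸[1+n] (suc m) (suc n) = m∸n≤1+m∸[1+n] m n

∣n-1+n∣≡1 : ∀ n → ∣ n - suc n ∣ ≡ 1
∣n-1+n∣≡1 zero    = refl
∣n-1+n∣≡1 (suc n) = ∣n-1+n∣≡1 n

∣-∣-step : ∀ a b c → ∣ a - b ∣ ≡ 1 → ∣ a - c ∣ ≤ suc ∣ b - c ∣
∣-∣-step a b c ∣a-b∣≡1 = ≤-trans (∣-∣-triangle a b c) (≤-reflexive (cong (_+ ∣ b - c ∣) ∣a-b∣≡1))

module Walks (H : Graph) where

  _++ʷ_ : ∀ {x y z ℓ ℓ′} → Walk H x y ℓ → Walk H y z ℓ′ → Walk H x z (ℓ + ℓ′)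
  here _     ++ʷ W′ = W′
  step xy W ++ʷ W′ = step xy (W ++ʷ W′)

  reverseʷ : (∀ {x y} → Adj H x y → Adj H y x) → ∀ {x y ℓ} → Walk H x y ℓ → Walk H y x ℓ
  reverseʷ flip (here x) = here x
  reverseʷ flip {ℓ = suc ℓ} (step xy W) =
    subst (Walk H _ _) (+-comm ℓ 1) (reverseʷ flip W ++ʷ step (flip xy) (here _))

  Lipschitz : (V H → ℕ) → Set
  Lipschitz φ = ∀ {x y} → Adj H x y → φ x ≤ suc (φ y)

  lipschitz-walk : ∀ {φ} → Lipschitz φ → ∀ {x y ℓ} → Walk H x y ℓ → φ x ≤ ℓ + φ y
  lipschitz-walk φ-lip (here x)    = ≤-refl
  lipschitz-walk φ-lip (step xy W) = ≤-trans (φ-lip xy) (s≤s (lipschitz-walk φ-lip W))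

  ⊓-lipschitz : ∀ {φ ψ} → Lipschitz φ → Lipschitz ψ → Lipschitz (λ z → φ z ⊓ ψ z)
  ⊓-lipschitz φ-lip ψ-lip xy = ⊓-glb (≤-trans (m⊓n≤m _ _) (φ-lip xy)) (≤-trans (m⊓n≤n _ _) (ψ-lip xy))

  +-lipschitz : ∀ c {φ} → Lipschitz φ → Lipschitz (λ z → c + φ z)
  +-lipschitz c {φ} φ-lip {x} {y} xy = subst (c + φ x ≤_) (+-suc c (φ y)) (+-monoʳ-≤ c (φ-lip xy))

module Subdivision {k : ℕ} (G : SimpleGraph k) (m : ℕ) where

  H : Graph
  H = subdivision G (suc m)

  SV : Set
  SV = SubV G (suc m)

  open Walks H public

  sr tg : Edge G → Fin k
  sr = src {G = G}
  tg = tgt {G = G}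

  edge-≡ : ∀ {e f : Edge G} → proj₁ e ≡ proj₁ f → e ≡ f
  edge-≡ {p , t} {.p , t′} refl = cong (p ,_) (T-irrelevant t t′)

  _≟E_ : (e f : Edge G) → Dec (e ≡ f)
  e ≟E f with proj₁ e ≟² proj₁ f
  ... | yes eq = yes (edge-≡ eq)
  ... | no neq = no (neq ∘ cong proj₁)

  sr<tg : ∀ e → toℕ (sr e) < toℕ (tg e)
  sr<tg e = <ᵇ⇒< _ _ (proj₁ (Equivalence.to T-∧ (proj₂ e)))

  sr-adj-tg : ∀ e → T (adj G (sr e) (tg e))
  sr-adj-tg e = proj₂ (Equivalence.to T-∧ (proj₂ e))

  sr≢tg : ∀ e → sr e ≢ tg e
  sr≢tg e eq = <⇒≢ (sr<tg e) (cong toℕ eq)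

  reverse : ∀ {x y ℓ} → Walk H x y ℓ → Walk H y x ℓ
  reverse = reverseʷ Sum.swap

  arcwise-lipschitz : ∀ {φ} → (∀ {x y} → SubArc G (suc m) x y → φ x ≤ suc (φ y) × φ y ≤ suc (φ x)) → Lipschitz φ
  arcwise-lipschitz both (inj₁ arc) = proj₁ (both arc)
  arcwise-lipschitz both (inj₂ arc) = proj₂ (both arc)

  -- distFrom u z is the distance from u to z, truncated at m + 1
  distFrom : Fin k → SV → ℕ
  distFrom u (inj₁ w) with u ≟ w
  ... | yes _ = 0
  ... | no _  = suc m
  distFrom u (inj₂ (f , i)) with sr f ≟ u
  ... | yes _ = suc (toℕ i)
  ... | no _ with tg f ≟ u
  ...   | yes _ = m ∸ toℕ i
  ...   | no _  = suc m

  distFrom-self : ∀ u → distFrom u (inj₁ u) ≡ 0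
  distFrom-self u with u ≟ u
  ... | yes _ = refl
  ... | no u≢u = ⊥-elim (u≢u refl)

  distFrom-other : ∀ {u w} → u ≢ w → distFrom u (inj₁ w) ≡ suc m
  distFrom-other {u} {w} u≢w with u ≟ w
  ... | yes u≡w = ⊥-elim (u≢w u≡w)
  ... | no _    = refl

  data EndOf (u : Fin k) (f : Edge G) : Set where
    is-src : sr f ≡ u → EndOf u f
    is-tgt : tg f ≡ u → EndOf u f
    not-end : sr f ≢ u → tg f ≢ u → EndOf u f

  endOf : ∀ u f → EndOf u f
  endOf u f with sr f ≟ u | tg f ≟ u
  ... | yes s≡u | _       = is-src s≡u
  ... | no _    | yes t≡u = is-tgt t≡u
  ... | no s≢u  | no t≢u  = not-end s≢u t≢u

  distFrom-src : ∀ {u} f i → sr f ≡ u → distFrom u (inj₂ (f , i)) ≡ suc (toℕ i)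
  distFrom-src {u} f i s≡u with sr f ≟ u
  ... | yes _   = refl
  ... | no s≢u = ⊥-elim (s≢u s≡u)

  distFrom-tgt : ∀ {u} f i → tg f ≡ u → distFrom u (inj₂ (f , i)) ≡ m ∸ toℕ i
  distFrom-tgt {u} f i t≡u with sr f ≟ u
  ... | yes s≡u = ⊥-elim (sr≢tg f (trans s≡u (sym t≡u)))
  ... | no _ with tg f ≟ u
  ...   | yes _   = refl
  ...   | no t≢u = ⊥-elim (t≢u t≡u)

  distFrom-not-end : ∀ {u} f i → sr f ≢ u → tg f ≢ u → distFrom u (inj₂ (f , i)) ≡ suc m
  distFrom-not-end {u} f i s≢u t≢u with sr f ≟ u
  ... | yes s≡u = ⊥-elim (s≢u s≡u)
  ... | no _ with tg f ≟ u
  ...   | yes t≡u = ⊥-elim (t≢u t≡u)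
  ...   | no _    = refl

  distFrom≤ : ∀ u z → distFrom u z ≤ suc m
  distFrom≤ u (inj₁ w) with u ≟ w
  ... | yes _ = z≤n
  ... | no _  = ≤-refl
  distFrom≤ u (inj₂ (f , i)) with endOf u f
  ... | is-src s≡u = ≤-trans (≤-reflexive (distFrom-src f i s≡u)) (m≤n⇒m≤1+n (toℕ<n i))
  ... | is-tgt t≡u = ≤-trans (≤-reflexive (distFrom-tgt f i t≡u)) (m≤n⇒m≤1+n (m∸n≤m m (toℕ i)))
  ... | not-end s≢u t≢u = ≤-reflexive (distFrom-not-end f i s≢u t≢u)

  distFrom-lipschitz : ∀ u → Lipschitz (distFrom u)
  distFrom-lipschitz u = arcwise-lipschitz arc
    where
    arc : ∀ {x y} → SubArc G (suc m) x y → distFrom u x ≤ suc (distFrom u y) × distFrom u y ≤ suc (distFrom u x)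
    arc {x} {y} (whole e refl) = ≤-trans (distFrom≤ u x) (s≤s z≤n) , ≤-trans (distFrom≤ u y) (s≤s z≤n)
    arc (first e i i≡0) with u ≟ sr e | endOf u e
    ... | yes refl | _ rewrite distFrom-src e i refl | i≡0 = z≤n , s≤s z≤n
    ... | no u≢s | is-src s≡u = ⊥-elim (u≢s (sym s≡u))
    ... | no u≢s | is-tgt t≡u rewrite distFrom-tgt e i t≡u | i≡0 = ≤-refl , m≤n⇒m≤1+n (n≤1+n m)
    ... | no u≢s | not-end s≢u t≢u rewrite distFrom-not-end e i s≢u t≢u = n≤1+n _ , n≤1+n _
    arc (middle e i j j≡1+i) with endOf u e
    ... | is-src s≡u rewrite distFrom-src e i s≡u | distFrom-src e j s≡u | j≡1+i = m≤n⇒m≤1+n (n≤1+n _) , ≤-refl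
    ... | is-tgt t≡u rewrite distFrom-tgt e i t≡u | distFrom-tgt e j t≡u | j≡1+i =
      m∸n≤1+m∸[1+n] m (toℕ i) , m≤n⇒m≤1+n (∸-monoʳ-≤ m (n≤1+n (toℕ i)))
    ... | not-end s≢u t≢u rewrite distFrom-not-end e i s≢u t≢u | distFrom-not-end e j s≢u t≢u = n≤1+n _ , n≤1+n _
    arc (last e i 2+i≡1+m) with u ≟ tg e | endOf u e
    ... | yes refl | _ rewrite distFrom-tgt e i refl =
      ≤-reflexive (trans (cong (_∸ toℕ i) (sym (suc-injective 2+i≡1+m))) (m+n∸n≡m 1 (toℕ i))) , z≤n
    ... | no u≢t | is-src s≡u rewrite distFrom-src e i s≡u | suc-injective 2+i≡1+m = m≤n⇒m≤1+n (n≤1+n _) , ≤-refl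
    ... | no u≢t | is-tgt t≡u = ⊥-elim (u≢t (sym t≡u))
    ... | no u≢t | not-end s≢u t≢u rewrite distFrom-not-end e i s≢u t≢u = n≤1+n _ , n≤1+n _

  data Dart (f : Edge G) (v w : Fin k) : Set where
    forward  : sr f ≡ v → tg f ≡ w → Dart f v w
    backward : tg f ≡ v → sr f ≡ w → Dart f v w

  -- the internal vertex (f , i) lies at distance suc (depth d i) from the start v of the dart d
  depth : ∀ {f v w} → Dart f v w → Fin m → ℕ
  depth (forward _ _)  i = toℕ i
  depth (backward _ _) i = m ∸ suc (toℕ i)

  suc-depth-backward : ∀ (i : Fin m) → m ∸ toℕ i ≡ suc (m ∸ suc (toℕ i))
  suc-depth-backward i = +-∸-assoc 1 (toℕ<n i)

  m∸depth-backward : ∀ (i : Fin m) → m ∸ (m ∸ suc (toℕ i)) ≡ suc (toℕ i)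
  m∸depth-backward i = m∸[m∸n]≡n (toℕ<n i)

  depth≤m : ∀ {f v w} (d : Dart f v w) i → depth d i ≤ m
  depth≤m (forward _ _)  i = <⇒≤ (toℕ<n i)
  depth≤m (backward _ _) i = m∸n≤m m (suc (toℕ i))

  dart-adj : ∀ {f v w} → Dart f v w → T (adj G v w)
  dart-adj {f} (forward refl refl)  = sr-adj-tg f
  dart-adj {f} (backward refl refl) = subst T (adj-sym G (sr f) (tg f)) (sr-adj-tg f)

  dart-edge-unique : ∀ {f e v w} → Dart f v w → Dart e v w → f ≡ e
  dart-edge-unique (forward s t) (forward s′ t′) = edge-≡ (cong₂ _,_ (trans s (sym s′)) (trans t (sym t′)))
  dart-edge-unique (backward t s) (backward t′ s′) = edge-≡ (cong₂ _,_ (trans s (sym s′)) (trans t (sym t′)))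
  dart-edge-unique {f} {e} (forward s t) (backward t′ s′) =
    ⊥-elim (<-asym (sr<tg f) (subst₂ _<_ (cong toℕ (trans s′ (sym t))) (cong toℕ (trans t′ (sym s))) (sr<tg e)))
  dart-edge-unique {f} {e} (backward t s) (forward s′ t′) =
    ⊥-elim (<-asym (sr<tg e) (subst₂ _<_ (cong toℕ (trans s (sym t′))) (cong toℕ (trans t (sym s′))) (sr<tg f)))

  dart-reversed : ∀ {f v w v′ w′} → Dart f v w → Dart f v′ w′ → v ≢ v′ → v′ ≡ w × w′ ≡ v
  dart-reversed (forward s t)  (forward s′ t′)  v≢v′ = ⊥-elim (v≢v′ (trans (sym s) s′))
  dart-reversed (forward s t)  (backward t′ s′) v≢v′ = trans (sym t′) t , trans (sym s′) s
  dart-reversed (backward t s) (forward s′ t′)  v≢v′ = trans (sym s′) s , trans (sym t′) t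
  dart-reversed (backward t s) (backward t′ s′) v≢v′ = ⊥-elim (v≢v′ (trans (sym t) t′))

  dart-end-unique : ∀ {f v w w′} → Dart f v w → Dart f v w′ → w ≡ w′
  dart-end-unique (forward _ t)  (forward _ t′)  = trans (sym t) t′
  dart-end-unique (backward _ s) (backward _ s′) = trans (sym s) s′
  dart-end-unique {f} (forward s _)  (backward t _) = ⊥-elim (sr≢tg f (trans s (sym t)))
  dart-end-unique {f} (backward t _) (forward s _)  = ⊥-elim (sr≢tg f (trans s (sym t)))

  dartOf : ∀ {v w} → T (adj G v w) → Σ (Edge G) λ e → Dart e v w
  dartOf {v} {w} vw with toℕ v <? toℕ w
  ... | yes v<w = ((v , w) , Equivalence.from T-∧ (<⇒<ᵇ v<w , vw)) , forward refl refl
  ... | no v≮w  = ((w , v) , Equivalence.from T-∧ (<⇒<ᵇ w<v , subst T (adj-sym G v w) vw)) , backward refl refl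
    where
    w<v : toℕ w < toℕ v
    w<v = ≤∧≢⇒< (≮⇒≥ v≮w) λ eq → subst T (irrefl G v) (subst (λ z → T (adj G v z)) (toℕ-injective eq) vw)

  depth-injective : ∀ {f v w w′} (d : Dart f v w) (d′ : Dart f v w′) {i j} → depth d i ≡ depth d′ j → i ≡ j
  depth-injective (forward _ _)  (forward _ _)  eq = toℕ-injective eq
  depth-injective (backward _ _) (backward _ _) {i} {j} eq =
    toℕ-injective (suc-injective (∸-cancelˡ-≡ (toℕ<n i) (toℕ<n j) eq))
  depth-injective {f} (forward s _)  (backward t _) eq = ⊥-elim (sr≢tg f (trans s (sym t)))
  depth-injective {f} (backward t _) (forward s _)  eq = ⊥-elim (sr≢tg f (trans s (sym t)))

  distFrom-near : ∀ {f v w} (d : Dart f v w) i → distFrom v (inj₂ (f , i)) ≡ suc (depth d i)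
  distFrom-near {f} (forward s≡v _)  i = distFrom-src f i s≡v
  distFrom-near {f} (backward t≡v _) i = trans (distFrom-tgt f i t≡v) (suc-depth-backward i)

  distFrom-far : ∀ {f v w u} (d : Dart f v w) i → u ≢ v → m ∸ depth d i ≤ distFrom u (inj₂ (f , i))
  distFrom-far {f} {u = u} d i u≢v with endOf u f | d
  ... | is-src s≡u | forward s≡v _  = ⊥-elim (u≢v (trans (sym s≡u) s≡v))
  ... | is-src s≡u | backward _ _   =
    ≤-reflexive (trans (m∸depth-backward i) (sym (distFrom-src f i s≡u)))
  ... | is-tgt t≡u | forward _ _    = ≤-reflexive (sym (distFrom-tgt f i t≡u))
  ... | is-tgt t≡u | backward t≡v _ = ⊥-elim (u≢v (trans (sym t≡u) t≡v))
  ... | not-end s≢u t≢u | d′ =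
    ≤-trans (m∸n≤m m (depth d′ i)) (≤-trans (n≤1+n m) (≤-reflexive (sym (distFrom-not-end f i s≢u t≢u))))

  distFrom-≥ : ∀ {f v w} (d : Dart f v w) i u → suc (depth d i) ⊓ (m ∸ depth d i) ≤ distFrom u (inj₂ (f , i))
  distFrom-≥ {v = v} d i u with u ≟ v
  ... | yes refl = ≤-trans (m⊓n≤m _ _) (≤-reflexive (sym (distFrom-near d i)))
  ... | no u≢v   = ≤-trans (m⊓n≤n _ _) (distFrom-far d i u≢v)

  module _ (e : Edge G) (j : Fin m) where

    alongEdge : SV → ℕ
    alongEdge (inj₁ _) = suc m
    alongEdge (inj₂ (f , i)) with f ≟E e
    ... | yes _ = ∣ toℕ i - toℕ j ∣
    ... | no _  = suc m

    viaEnds : SV → ℕ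
    viaEnds z = (suc (toℕ j) + distFrom (sr e) z) ⊓ ((m ∸ toℕ j) + distFrom (tg e) z)

    -- a lower bound for the distance from z to the internal vertex (e , j), truncated at m + 1
    distTo : SV → ℕ
    distTo z = alongEdge z ⊓ viaEnds z

    alongEdge-on : ∀ i → alongEdge (inj₂ (e , i)) ≡ ∣ toℕ i - toℕ j ∣
    alongEdge-on i with e ≟E e
    ... | yes _  = refl
    ... | no e≢e = ⊥-elim (e≢e refl)

    alongEdge-off : ∀ {f} i → f ≢ e → alongEdge (inj₂ (f , i)) ≡ suc m
    alongEdge-off {f} i f≢e with f ≟E e
    ... | yes f≡e = ⊥-elim (f≢e f≡e)
    ... | no _    = refl

    alongEdge≤ : ∀ z → alongEdge z ≤ suc m
    alongEdge≤ (inj₁ _) = ≤-refl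
    alongEdge≤ (inj₂ (f , i)) with f ≟E e
    ... | yes _ = ≤-trans (∣m-n∣≤m⊔n (toℕ i) (toℕ j)) (m≤n⇒m≤1+n (⊔-lub (<⇒≤ (toℕ<n i)) (<⇒≤ (toℕ<n j))))
    ... | no _  = ≤-refl

    distTo-self : distTo (inj₂ (e , j)) ≡ 0
    distTo-self = n≤0⇒n≡0 (≤-trans (m⊓n≤m _ _) (≤-reflexive (trans (alongEdge-on j) (∣n-n∣≡0 (toℕ j)))))

    viaEnds-lipschitz : Lipschitz viaEnds
    viaEnds-lipschitz = ⊓-lipschitz (+-lipschitz _ (distFrom-lipschitz (sr e))) (+-lipschitz _ (distFrom-lipschitz (tg e)))

    distTo≤off-edge : ∀ x y → alongEdge y ≡ suc m → distTo x ≤ suc (alongEdge y)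
    distTo≤off-edge x y eq rewrite eq = ≤-trans (m⊓n≤m _ _) (m≤n⇒m≤1+n (alongEdge≤ x))

    distTo≤along-arc : ∀ {x y} → SubArc G (suc m) x y → distTo x ≤ suc (alongEdge y) × distTo y ≤ suc (alongEdge x)
    distTo≤along-arc {x} {y} (whole _ _) = distTo≤off-edge x y refl , distTo≤off-edge y x refl
    distTo≤along-arc {x} {y} (first f i i≡0) = by-edge (f ≟E e) , distTo≤off-edge y x refl
      where
      by-edge : Dec (f ≡ e) → distTo x ≤ suc (alongEdge y)
      by-edge (no f≢e) = distTo≤off-edge x y (alongEdge-off i f≢e)
      by-edge (yes refl) rewrite alongEdge-on i | i≡0 =
        ≤-trans (m⊓n≤n _ _) (≤-trans (m⊓n≤m _ _)
          (≤-reflexive (trans (cong (suc (toℕ j) +_) (distFrom-self (sr e))) (cong suc (+-identityʳ (toℕ j))))))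
    distTo≤along-arc {x} {y} (middle f i i′ i′≡1+i) = by-edge (f ≟E e)
      where
      by-edge : Dec (f ≡ e) → distTo x ≤ suc (alongEdge y) × distTo y ≤ suc (alongEdge x)
      by-edge (no f≢e) = distTo≤off-edge x y (alongEdge-off i′ f≢e) , distTo≤off-edge y x (alongEdge-off i f≢e)
      by-edge (yes refl) rewrite alongEdge-on i | alongEdge-on i′ | i′≡1+i =
        ≤-trans (m⊓n≤m _ _) (∣-∣-step (toℕ i) (suc (toℕ i)) (toℕ j) (∣n-1+n∣≡1 (toℕ i))) ,
        ≤-trans (m⊓n≤m _ _) (∣-∣-step (suc (toℕ i)) (toℕ i) (toℕ j) (trans (∣-∣-comm (suc (toℕ i)) (toℕ i)) (∣n-1+n∣≡1 (toℕ i))))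
    distTo≤along-arc {x} {y} (last f i 2+i≡1+m) = distTo≤off-edge x y refl , by-edge (f ≟E e)
      where
      by-edge : Dec (f ≡ e) → distTo y ≤ suc (alongEdge x)
      by-edge (no f≢e) = distTo≤off-edge y x (alongEdge-off i f≢e)
      by-edge (yes refl) rewrite alongEdge-on i =
        ≤-trans (m⊓n≤n _ _) (≤-trans (m⊓n≤n _ _) (begin
          m ∸ toℕ j + distFrom (tg e) (inj₁ (tg e)) ≡⟨ cong (m ∸ toℕ j +_) (distFrom-self (tg e)) ⟩
          m ∸ toℕ j + 0                             ≡⟨ +-identityʳ _ ⟩
          m ∸ toℕ j                                 ≡⟨ cong (_∸ toℕ j) (suc-injective 2+i≡1+m) ⟨
          suc (toℕ i) ∸ toℕ j                       ≤⟨ m∸n≤∣m-n∣ (suc (toℕ i)) (toℕ j) ⟩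
          ∣ suc (toℕ i) - toℕ j ∣                   ≤⟨ ∣-∣-step (suc (toℕ i)) (toℕ i) (toℕ j) (trans (∣-∣-comm _ (toℕ i)) (∣n-1+n∣≡1 (toℕ i))) ⟩
          suc ∣ toℕ i - toℕ j ∣                     ∎))
        where open ≤-Reasoning

    distTo-lipschitz : Lipschitz distTo
    distTo-lipschitz xy = ⊓-glb (along xy) (≤-trans (m⊓n≤n _ _) (viaEnds-lipschitz xy))
      where
      along : ∀ {x y} → Adj H x y → distTo x ≤ suc (alongEdge y)
      along (inj₁ arc) = proj₁ (distTo≤along-arc arc)
      along (inj₂ arc) = proj₂ (distTo≤along-arc arc)

    distTo-far : ∀ {f v w} (d : Dart e v w) i → f ≢ e →
                 suc m ≤ suc (depth d j) + distFrom v (inj₂ (f , i)) →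
                 suc m ≤ (m ∸ depth d j) + distFrom w (inj₂ (f , i)) →
                 suc m ≤ distTo (inj₂ (f , i))
    distTo-far {f} (forward refl refl) i f≢e via-v via-w =
      ⊓-glb (≤-reflexive (sym (alongEdge-off i f≢e))) (⊓-glb via-v via-w)
    distTo-far {f} (backward refl refl) i f≢e via-v via-w =
      ⊓-glb (≤-reflexive (sym (alongEdge-off i f≢e)))
            (⊓-glb (subst (λ n → suc m ≤ n + distFrom (sr e) (inj₂ (f , i))) (m∸depth-backward j) via-w)
                   (subst (λ n → suc m ≤ n + distFrom (tg e) (inj₂ (f , i))) (sym (suc-depth-backward j)) via-v))

  walk-to-branch : ∀ {x u ℓ} → Walk H x (inj₁ u) ℓ → distFrom u x ≤ ℓ
  walk-to-branch {x} {u} {ℓ} W = ≤-trans (lipschitz-walk (distFrom-lipschitz u) W)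
    (≤-reflexive (trans (cong (ℓ +_) (distFrom-self u)) (+-identityʳ ℓ)))

  walk-to-internal : ∀ {x e j ℓ} → Walk H x (inj₂ (e , j)) ℓ → distTo e j x ≤ ℓ
  walk-to-internal {x} {e} {j} {ℓ} W = ≤-trans (lipschitz-walk (distTo-lipschitz e j) W)
    (≤-reflexive (trans (cong (ℓ +_) (distTo-self e j)) (+-identityʳ ℓ)))

  pointAt : Edge G → ℕ → SV
  pointAt e zero    = inj₁ (sr e)
  pointAt e (suc r) with r <? m
  ... | yes r<m = inj₂ (e , fromℕ< r<m)
  ... | no _    = inj₁ (tg e)

  pointAt-internal : ∀ e {r} (r<m : r < m) → pointAt e (suc r) ≡ inj₂ (e , fromℕ< r<m)
  pointAt-internal e {r} r<m with r <? m
  ... | yes r<m′ = cong (λ i → inj₂ (e , i)) (toℕ-injective (trans (toℕ-fromℕ< r<m′) (sym (toℕ-fromℕ< r<m))))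
  ... | no r≮m   = ⊥-elim (r≮m r<m)

  pointAt-end : ∀ e → pointAt e (suc m) ≡ inj₁ (tg e)
  pointAt-end e with m <? m
  ... | yes m<m = ⊥-elim (<-irrefl refl m<m)
  ... | no _    = refl

  pointAt-step : ∀ e {r} → r ≤ m → Adj H (pointAt e r) (pointAt e (suc r))
  pointAt-step e {zero} _ with 0 <? m
  ... | yes 0<m = inj₁ (first e (fromℕ< 0<m) (toℕ-fromℕ< 0<m))
  ... | no 0≮m  = inj₁ (whole e (cong suc (n≤0⇒n≡0 (≮⇒≥ 0≮m))))
  pointAt-step e {suc r} r<m rewrite pointAt-internal e r<m with suc r <? m
  ... | yes 1+r<m = inj₁ (middle e (fromℕ< r<m) (fromℕ< 1+r<m) (trans (toℕ-fromℕ< 1+r<m) (cong suc (sym (toℕ-fromℕ< r<m)))))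
  ... | no 1+r≮m  = inj₁ (last e (fromℕ< r<m) (cong suc (trans (cong suc (toℕ-fromℕ< r<m)) (≤-antisym r<m (≮⇒≥ 1+r≮m)))))

  walk-along : ∀ e p n → p + n ≤ suc m → Walk H (pointAt e p) (pointAt e (p + n)) n
  walk-along e p zero    _  = subst (λ q → Walk H (pointAt e p) (pointAt e q) 0) (sym (+-identityʳ p)) (here _)
  walk-along e p (suc n) le = step (pointAt-step e (≤-pred (≤-trans (s≤s (m≤m+n p n)) le′)))
    (subst (λ q → Walk H (pointAt e (suc p)) (pointAt e q) n) (sym (+-suc p n)) (walk-along e (suc p) n le′))
    where
    le′ : suc p + n ≤ suc m
    le′ = ≤-trans (≤-reflexive (sym (+-suc p n))) le

  distFrom-pointAt-src : ∀ e {r} → r ≤ suc m → distFrom (sr e) (pointAt e r) ≡ r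
  distFrom-pointAt-src e {zero}  _  = distFrom-self (sr e)
  distFrom-pointAt-src e {suc r} le with m≤n⇒m<n∨m≡n (≤-pred le)
  ... | inj₁ r<m rewrite pointAt-internal e r<m = trans (distFrom-src e _ refl) (cong suc (toℕ-fromℕ< r<m))
  ... | inj₂ refl rewrite pointAt-end e = distFrom-other (sr≢tg e)

  distFrom-pointAt-tgt : ∀ e {r} → r ≤ suc m → distFrom (tg e) (pointAt e r) ≡ suc m ∸ r
  distFrom-pointAt-tgt e {zero}  _  = distFrom-other (sr≢tg e ∘ sym)
  distFrom-pointAt-tgt e {suc r} le with m≤n⇒m<n∨m≡n (≤-pred le)
  ... | inj₁ r<m rewrite pointAt-internal e r<m = trans (distFrom-tgt e _ refl) (cong (m ∸_) (toℕ-fromℕ< r<m))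
  ... | inj₂ refl rewrite pointAt-end e = trans (distFrom-self (tg e)) (sym (n∸n≡0 r))

  point : ∀ {e v w} → Dart e v w → ℕ → SV
  point {e} (forward _ _)  r = pointAt e r
  point {e} (backward _ _) r = pointAt e (suc m ∸ r)

  distFrom-point : ∀ {e v w} (d : Dart e v w) {r} → r ≤ suc m → distFrom v (point d r) ≡ r
  distFrom-point {e} (forward refl _)  le = distFrom-pointAt-src e le
  distFrom-point {e} (backward refl _) {r} le = trans (distFrom-pointAt-tgt e (m∸n≤m (suc m) r)) (m∸[m∸n]≡n le)

  walk-from-start : ∀ {e v w} (d : Dart e v w) {r} → r ≤ suc m → Walk H (inj₁ v) (point d r) r
  walk-from-start {e} (forward refl _) {r} le = walk-along e 0 r le
  walk-from-start {e} (backward refl _) {r} le =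
    reverse (subst (λ z → Walk H (pointAt e (suc m ∸ r)) z r) (trans (cong (pointAt e) (m∸n+n≡m le)) (pointAt-end e))
                   (walk-along e (suc m ∸ r) r (≤-reflexive (m∸n+n≡m le))))

  point-internal : ∀ {e v w} (d : Dart e v w) {r} → 1 ≤ r → r ≤ m → ∃ λ i → point d r ≡ inj₂ (e , i)
  point-internal {e} (forward _ _)  {suc a} _ a<m = _ , pointAt-internal e a<m
  point-internal {e} (backward _ _) {suc a} _ a<m =
    _ , trans (cong (pointAt e) (+-∸-assoc 1 a<m)) (pointAt-internal e (∸-monoʳ-< (s≤s z≤n) a<m))

module Palette (B t D : ℕ) where

  Palette : Set
  Palette = Fin B ⊎ (Fin t × Fin D)

  encode : Palette → Fin (B + t * D)
  encode = join B (t * D) ∘ Sum.map₂ (uncurry combine)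

  decode : Fin (B + t * D) → Palette
  decode = Sum.map₂ (remQuot D) ∘ splitAt B

  decode-encode : ∀ c → decode (encode c) ≡ c
  decode-encode (inj₁ b) = cong (Sum.map₂ (remQuot D)) (splitAt-join B (t * D) (inj₁ b))
  decode-encode (inj₂ (a , ℓ)) =
    trans (cong (Sum.map₂ (remQuot D)) (splitAt-join B (t * D) (inj₂ (combine a ℓ)))) (cong inj₂ (remQuot-combine a ℓ))

  encode-decode : ∀ i → encode (decode i) ≡ i
  encode-decode i with splitAt B i in eq
  ... | inj₁ b = trans (cong (join B (t * D)) (sym eq)) (join-splitAt B (t * D) i)
  ... | inj₂ c = trans (cong (λ c → join B (t * D) (inj₂ c)) (combine-remQuot {t} D c))
                       (trans (cong (join B (t * D)) (sym eq)) (join-splitAt B (t * D) i))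

  decode-injective : ∀ {i j} → decode i ≡ decode j → i ≡ j
  decode-injective {i} {j} eq = trans (sym (encode-decode i)) (trans (cong encode eq) (encode-decode j))

  encode-injective : ∀ {c c′} → encode c ≡ encode c′ → c ≡ c′
  encode-injective {c} {c′} eq = trans (sym (decode-encode c)) (trans (cong decode eq) (decode-encode c′))

module Colouring {k} (G : SimpleGraph k) (m t : ℕ) (2t≤m : t + t ≤ m) (m≤2t+1 : m ≤ suc (t + t))
                 {D} {lab : Labelling {k} {D}} (dl : IsDartLabelling (λ u v → T (adj G u v)) lab) where

  open Subdivision G m
  open IsDartLabelling dl

  B : ℕ
  B = suc (m ∸ (t + t))

  open Palette B t D

  -- between the near zones of the two ends of an edge there is at most one vertex, and only for odd m
  data Position (f : Edge G) (i : Fin m) : Set where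
    near   : ∀ {v w} (d : Dart f v w) → depth d i < t → Position f i
    centre : toℕ i ≡ t → m ≡ suc (t + t) → Position f i

  beyond-near-zones : ∀ {i} → i < m → t ≤ i → t ≤ m ∸ suc i → i ≡ t × m ≡ suc (t + t)
  beyond-near-zones {i} i<m t≤i t≤m∸[1+i] = i≡t , m≡2t+1
    where
    t+1+i≤m : t + suc i ≤ m
    t+1+i≤m = m≤o∸n⇒m+n≤o t i<m t≤m∸[1+i]
    m≡2t+1 : m ≡ suc (t + t)
    m≡2t+1 = ≤-antisym m≤2t+1 (≤-trans (≤-reflexive (sym (+-suc t t))) (≤-trans (+-monoʳ-≤ t (s≤s t≤i)) t+1+i≤m))
    i≡t : i ≡ t
    i≡t = ≤-antisym (+-cancelˡ-≤ t i t (≤-pred (≤-trans (≤-reflexive (sym (+-suc t i))) (≤-trans t+1+i≤m m≤2t+1)))) t≤i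

  position : ∀ f i → Position f i
  position f i with toℕ i <? t | m ∸ suc (toℕ i) <? t
  ... | yes i<t | _          = near (forward refl refl) i<t
  ... | no _    | yes m∸i<t  = near (backward refl refl) m∸i<t
  ... | no i≮t  | no m∸i≮t   = uncurry centre (beyond-near-zones (toℕ<n i) (≮⇒≥ i≮t) (≮⇒≥ m∸i≮t))

  centre-slot : m ≡ suc (t + t) → Fin (m ∸ (t + t))
  centre-slot m≡2t+1 = fromℕ< (subst (λ n → 0 < n ∸ (t + t)) (sym m≡2t+1) (≤-reflexive (sym (m+n∸n≡m 1 (t + t)))))

  colourAt : ∀ {f i} → Position f i → Palette
  colourAt (near {v} {w} _ a<t) = inj₂ (fromℕ< a<t , lab v w)
  colourAt (centre _ m≡2t+1)    = inj₁ (suc (centre-slot m≡2t+1))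

  colour : SV → Palette
  colour (inj₁ _)        = inj₁ zero
  colour (inj₂ (f , i)) = colourAt (position f i)

  1+a+[m∸a]≡1+m : ∀ {a} → a ≤ m → suc a + (m ∸ a) ≡ suc m
  1+a+[m∸a]≡1+m a≤m = cong suc (m+[n∸m]≡n a≤m)

  near⇒1+a≤m∸a : ∀ {a} → a < t → suc a ≤ m ∸ a
  near⇒1+a≤m∸a {a} a<t = m+n≤o⇒m≤o∸n (suc a) (≤-trans (+-mono-≤ a<t (<⇒≤ a<t)) 2t≤m)

  near-apart : ∀ {f i e j v w v′ w′} (d : Dart f v w) (d′ : Dart e v′ w′) →
               depth d i < t → depth d i ≡ depth d′ j → lab v w ≡ lab v′ w′ →
               _≢_ {A = SV} (inj₂ (f , i)) (inj₂ (e , j)) → ¬ distTo e j (inj₂ (f , i)) ≤ m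
  near-apart {f} {i} {e} {j} {v} {w} {v′} {w′} d d′ a<t same-depth same-label x≢y close with v ≟ v′
  ... | yes refl with refl ← injective-at v w w′ (dart-adj d) (dart-adj d′) same-label
                 with refl ← dart-edge-unique d d′
    = x≢y (cong (λ i → inj₂ (f , i)) (depth-injective d d′ same-depth))
  ... | no v≢v′ = by-edge (f ≟E e)
    where
    open ≤-Reasoning
    a : ℕ
    a = depth d i
    via-v′ : suc m ≤ suc (depth d′ j) + distFrom v′ (inj₂ (f , i))
    via-v′ = begin
      suc m                             ≡⟨ 1+a+[m∸a]≡1+m (depth≤m d i) ⟨
      suc a + (m ∸ a)                   ≤⟨ +-mono-≤ (≤-reflexive (cong suc same-depth)) (distFrom-far d i (v≢v′ ∘ sym)) ⟩
      suc (depth d′ j) + distFrom v′ (inj₂ (f , i)) ∎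
    via-w′ : suc m ≤ (m ∸ depth d′ j) + distFrom w′ (inj₂ (f , i))
    via-w′ = begin
      suc m                             ≡⟨ trans (+-comm (m ∸ a) (suc a)) (1+a+[m∸a]≡1+m (depth≤m d i)) ⟨
      (m ∸ a) + suc a                   ≡⟨ cong₂ _+_ (cong (m ∸_) same-depth) (sym (m≤n⇒m⊓n≡m (near⇒1+a≤m∸a a<t))) ⟩
      (m ∸ depth d′ j) + (suc a ⊓ (m ∸ a)) ≤⟨ +-monoʳ-≤ (m ∸ depth d′ j) (distFrom-≥ d i w′) ⟩
      (m ∸ depth d′ j) + distFrom w′ (inj₂ (f , i)) ∎
    by-edge : Dec (f ≡ e) → ⊥
    by-edge (yes refl) with v′≡w , w′≡v ← dart-reversed d d′ v≢v′
      = ends-differ v w (dart-adj d) (trans same-label (cong₂ lab v′≡w w′≡v))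
    by-edge (no f≢e) = <⇒≱ (s≤s close) (distTo-far e j d′ i f≢e via-v′ via-w′)

  centre-apart : ∀ {f i e j} → toℕ i ≡ t → toℕ j ≡ t → m ≡ suc (t + t) →
                 _≢_ {A = SV} (inj₂ (f , i)) (inj₂ (e , j)) → ¬ distTo e j (inj₂ (f , i)) ≤ m
  centre-apart {f} {i} {e} {j} i≡t j≡t m≡2t+1 x≢y close = by-edge (f ≟E e)
    where
    m∸t≡1+t : m ∸ t ≡ suc t
    m∸t≡1+t = trans (cong (_∸ t) m≡2t+1) (trans (cong (_∸ t) (sym (+-suc t t))) (m+n∸m≡n t (suc t)))
    1+t≤dist : ∀ u → suc t ≤ distFrom u (inj₂ (f , i))
    1+t≤dist u = subst (_≤ distFrom u (inj₂ (f , i)))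
      (trans (cong₂ (λ a b → suc a ⊓ (m ∸ b)) i≡t i≡t) (trans (cong (suc t ⊓_) m∸t≡1+t) (⊓-idem (suc t))))
      (distFrom-≥ {f = f} (forward refl refl) i u)
    1+m≡[1+t]+[1+t] : suc m ≡ suc t + suc t
    1+m≡[1+t]+[1+t] = cong suc (trans m≡2t+1 (sym (+-suc t t)))
    via : ∀ {c} u → c ≡ suc t → suc m ≤ c + distFrom u (inj₂ (f , i))
    via u refl = ≤-trans (≤-reflexive 1+m≡[1+t]+[1+t]) (+-monoʳ-≤ (suc t) (1+t≤dist u))
    by-edge : Dec (f ≡ e) → ⊥
    by-edge (yes refl) = x≢y (cong (λ i → inj₂ (f , i)) (toℕ-injective (trans i≡t (sym j≡t))))
    by-edge (no f≢e)   = <⇒≱ (s≤s close) (distTo-far e j (forward refl refl) i f≢e (via (sr e) (cong suc j≡t)) (via (tg e) (trans (cong (m ∸_) j≡t) m∸t≡1+t)))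

  near-colour-injective : ∀ {a b} {a<t : a < t} {b<t : b < t} {ℓ ℓ′} →
    _≡_ {A = Palette} (inj₂ (fromℕ< a<t , ℓ)) (inj₂ (fromℕ< b<t , ℓ′)) → a ≡ b × ℓ ≡ ℓ′
  near-colour-injective {a<t = a<t} {b<t} eq with same-slot , same-label ← ,-injective (inj₂-injective eq)
    = trans (sym (toℕ-fromℕ< a<t)) (trans (cong toℕ same-slot) (toℕ-fromℕ< b<t)) , same-label

  internal-colour≢branch : ∀ f i → colour (inj₂ (f , i)) ≢ inj₁ zero
  internal-colour≢branch f i with position f i
  ... | near _ _   = λ ()
  ... | centre _ _ = λ ()

  colour-proper : ∀ {x y ℓ} → x ≢ y → ℓ ≤ m → Walk H x y ℓ → colour x ≢ colour y
  colour-proper {inj₁ u} {inj₁ w} x≢y ℓ≤m W _ =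
    1+n≰n (≤-trans (≤-reflexive (sym (distFrom-other (x≢y ∘ cong inj₁ ∘ sym)))) (≤-trans (walk-to-branch W) ℓ≤m))
  colour-proper {inj₁ _} {inj₂ (e , j)} _ _ _ eq = internal-colour≢branch e j (sym eq)
  colour-proper {inj₂ (f , i)} {inj₁ _} _ _ _ eq = internal-colour≢branch f i eq
  colour-proper {inj₂ (f , i)} {inj₂ (e , j)} x≢y ℓ≤m W eq with position f i | position e j
  ... | near d a<t | near d′ b<t with same-depth , same-label ← near-colour-injective {a<t = a<t} {b<t} eq
    = near-apart d d′ a<t same-depth same-label x≢y (≤-trans (walk-to-internal W) ℓ≤m)
  ... | centre i≡t m≡2t+1 | centre j≡t _ = centre-apart i≡t j≡t m≡2t+1 x≢y (≤-trans (walk-to-internal W) ℓ≤m)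
  ... | near _ _   | centre _ _ with () ← eq
  ... | centre _ _ | near _ _   with () ← eq

  colouring : Colorable (fracPower G m (suc m)) (B + t * D)
  colouring = encode ∘ colour , λ x y (x≢y , ℓ , ℓ≤m , W) → colour-proper x≢y ℓ≤m W ∘ encode-injective

module Clique {k} (G : SimpleGraph k) (m t : ℕ) (2t≤m : t + t ≤ m) (m≤2t+1 : m ≤ suc (t + t))
              {u : Fin k} {D} (nb : NeighbourEnumeration G u D) (s₀ : Fin D) where

  open Subdivision G m

  B : ℕ
  B = suc (m ∸ (t + t))

  open Palette B t D

  neighbour : Fin D → Fin k
  neighbour = proj₁ nb

  edge : Fin D → Edge G
  edge s = proj₁ (dartOf (proj₂ (proj₂ nb) s))

  dart : ∀ s → Dart (edge s) u (neighbour s)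
  dart s = proj₂ (dartOf (proj₂ (proj₂ nb) s))

  -- the palette also indexes a clique: u, the points at distance 1, …, t from u on every edge at u,
  -- and for odd m the point at distance t + 1 on the edge s₀
  radius : Palette → ℕ
  radius (inj₁ zero)    = 0
  radius (inj₁ (suc _)) = suc t
  radius (inj₂ (a , _)) = suc (toℕ a)

  spoke : Palette → Fin D
  spoke (inj₁ _)       = s₀
  spoke (inj₂ (_ , s)) = s

  vertex : Palette → SV
  vertex c = point (dart (spoke c)) (radius c)

  centre⇒odd : Fin (m ∸ (t + t)) → m ≡ suc (t + t)
  centre⇒odd x = ≤-antisym m≤2t+1 (m≤o∸n⇒m+n≤o 1 2t≤m (≤-trans (s≤s z≤n) (toℕ<n x)))

  centre-slot-unique : (x y : Fin (m ∸ (t + t))) → x ≡ y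
  centre-slot-unique x y = toℕ-injective (trans (slot≡0 x) (sym (slot≡0 y)))
    where
    slot≡0 : ∀ z → toℕ z ≡ 0
    slot≡0 z = n<1⇒n≡0 (≤-trans (toℕ<n z) (≤-trans (∸-monoˡ-≤ (t + t) m≤2t+1) (≤-reflexive (m+n∸n≡m 1 (t + t)))))

  radius≤m : ∀ c → radius c ≤ m
  radius≤m (inj₁ zero)    = z≤n
  radius≤m (inj₁ (suc x)) = subst (suc t ≤_) (sym (centre⇒odd x)) (s≤s (m≤m+n t t))
  radius≤m (inj₂ (a , _)) = ≤-trans (toℕ<n a) (≤-trans (m≤m+n t t) 2t≤m)

  radii-sum : ∀ c c′ → c ≢ c′ → radius c + radius c′ ≤ m
  radii-sum (inj₁ zero)    c′             _   = radius≤m c′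
  radii-sum c              (inj₁ zero)    _   = subst (_≤ m) (sym (+-identityʳ (radius c))) (radius≤m c)
  radii-sum (inj₁ (suc x)) (inj₁ (suc y)) x≢y = ⊥-elim (x≢y (cong (inj₁ ∘ suc) (centre-slot-unique x y)))
  radii-sum (inj₁ (suc x)) (inj₂ (b , _)) _   =
    subst (suc t + suc (toℕ b) ≤_) (sym (centre⇒odd x)) (s≤s (+-monoʳ-≤ t (toℕ<n b)))
  radii-sum (inj₂ (a , _)) (inj₁ (suc y)) _   =
    subst (suc (toℕ a) + suc t ≤_) (trans (+-suc t t) (sym (centre⇒odd y))) (+-monoˡ-≤ (suc t) (toℕ<n a))
  radii-sum (inj₂ (a , _)) (inj₂ (b , _)) _   = ≤-trans (+-mono-≤ (toℕ<n a) (toℕ<n b)) 2t≤m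

  radius-determined : ∀ {c c′} → vertex c ≡ vertex c′ → radius c ≡ radius c′
  radius-determined {c} {c′} eq =
    trans (sym (distFrom-point (dart (spoke c)) (m≤n⇒m≤1+n (radius≤m c))))
          (trans (cong (distFrom u) eq) (distFrom-point (dart (spoke c′)) (m≤n⇒m≤1+n (radius≤m c′))))

  spoke-determined : ∀ {c c′} → 1 ≤ radius c → vertex c ≡ vertex c′ → spoke c ≡ spoke c′
  spoke-determined {c} {c′} 1≤r eq
    with i , on-c ← point-internal (dart (spoke c)) 1≤r (radius≤m c)
       | i′ , on-c′ ← point-internal (dart (spoke c′)) (subst (1 ≤_) (radius-determined eq) 1≤r) (radius≤m c′)
    = proj₁ (proj₂ nb) (dart-end-unique (dart (spoke c)) (subst (λ e → Dart e u (neighbour (spoke c′))) (sym same-edge) (dart (spoke c′))))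
    where
    same-edge : edge (spoke c) ≡ edge (spoke c′)
    same-edge = cong proj₁ (inj₂-injective (trans (sym on-c) (trans eq on-c′)))

  palette-determined : ∀ c c′ → radius c ≡ radius c′ → (1 ≤ radius c → spoke c ≡ spoke c′) → c ≡ c′
  palette-determined (inj₁ zero)    (inj₁ zero)     _  _ = refl
  palette-determined (inj₁ (suc x)) (inj₁ (suc y))  _  _ = cong (inj₁ ∘ suc) (centre-slot-unique x y)
  palette-determined (inj₁ (suc _)) (inj₂ (b , _))  r≡ _ = ⊥-elim (<-irrefl (sym (suc-injective r≡)) (toℕ<n b))
  palette-determined (inj₂ (a , _)) (inj₁ (suc _))  r≡ _ = ⊥-elim (<-irrefl (suc-injective r≡) (toℕ<n a))
  palette-determined (inj₂ (a , s)) (inj₂ (b , s′)) r≡ same-spoke =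
    cong₂ (λ a s → inj₂ (a , s)) (toℕ-injective (suc-injective r≡)) (same-spoke (s≤s z≤n))

  vertex-injective : ∀ {c c′} → vertex c ≡ vertex c′ → c ≡ c′
  vertex-injective {c} {c′} eq = palette-determined c c′ (radius-determined eq) (λ 1≤r → spoke-determined 1≤r eq)

  clique : HasClique (fracPower G m (suc m)) (B + t * D)
  clique = vertex ∘ decode , λ i j i≢j →
    (i≢j ∘ decode-injective ∘ vertex-injective) ,
    radius (decode i) + radius (decode j) , radii-sum (decode i) (decode j) (i≢j ∘ decode-injective) ,
    reverse (spoke-walk (decode i)) ++ʷ spoke-walk (decode j)
    where
    spoke-walk : ∀ c → Walk H (inj₁ u) (vertex c) (radius c)
    spoke-walk c = walk-from-start (dart (spoke c)) (m≤n⇒m≤1+n (radius≤m c))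

clique≤colours : ∀ (H : Graph) {a b} → HasClique H a → Colorable H b → a ≤ b
clique≤colours H (K , K-adj) (col , col-proper) = injective⇒≤ col∘K-injective
  where
  col∘K-injective : ∀ {i j} → col (K i) ≡ col (K j) → i ≡ j
  col∘K-injective {i} {j} same with i ≟ j
  ... | yes i≡j = i≡j
  ... | no i≢j  = contradiction same (col-proper (K i) (K j) (K-adj i j i≢j))

halve : ∀ m → ∃ λ t → t + t ≤ m × m ≤ suc (t + t)
halve zero          = 0 , z≤n , z≤n
halve (suc zero)    = 0 , z≤n , ≤-refl
halve (suc (suc m)) with t , 2t≤m , m≤2t+1 ← halve m =
  suc t , subst (_≤ suc (suc m)) (cong suc (sym (+-suc t t))) (s≤s (s≤s 2t≤m)) ,
          subst (suc (suc m) ≤_) (cong (2 +_) (sym (+-suc t t))) (s≤s (s≤s m≤2t+1))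

theorem4 : ∀ {k} (G : SimpleGraph k) → Connected (toGraph G) → 3 ≤ Δ G →
    (m : ℕ) → ∃ λ c → IsChromaticNumber (fracPower G m (suc m)) c
                    × IsCliqueNumber (fracPower G m (suc m)) c
theorem4 G _ 3≤Δ m with t , 2t≤m , m≤2t+1 ← halve m
                    | lab , dl ← dartLabelling G (degree≤Δ G) (≤-trans (n≤1+n 2) 3≤Δ)
                    | u , deg-u≡Δ ← Δ-attained G (≤-trans (s≤s z≤n) 3≤Δ) =
  _ , (colouring , λ _ → clique≤colours _ clique) , (clique , λ _ K → clique≤colours _ K colouring)
  where
  open Colouring G m t 2t≤m m≤2t+1 dl using (colouring)
  open Clique G m t 2t≤m m≤2t+1 (subst (NeighbourEnumeration G u) deg-u≡Δ (neighbourEnumeration G u))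
                                (fromℕ< (≤-trans (s≤s z≤n) 3≤Δ)) using (clique)
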